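{- Let $G$ be a finite connected multigraph (loops and multiple edges allowed) with vertex set $\{0,1,\dots,n\}$ and let $\tau$ be a vertex ranking of $[n]$. Let $u\in[n]$ be a vertex adjacent to $0$ with $\tau(u)\le\tau(w)$ for every vertex $w\in[n]$ adjacent to $0$, and let $e$ be an edge joining $0$ and $u$. Let $\mathcal{P}_G^1=\{f\in\mathcal{P}_G: f(u)\ge1\}$ and, for $f\in\mathcal{P}_G^1$, let $\varphi(f)$ be the function with $\varphi(f)(w)=f(w)$ for $w\ne u$ and $\varphi(f)(u)=f(u)-1$. Let $G-e$ be the graph obtained from $G$ by deleting the edge $e$, with the same ranking $\tau$. Then: (1) $\varphi$ is a bijection from $\mathcal{P}_G^1$ to $\mathcal{P}_{G-e}$, and $w_{G-e}(\varphi(f))=w_G(f)$ for all $f\in\mathcal{P}_G^1$; (2) for every $f\in\mathcal{P}_G^1$, $B_{G,\tau}(f)=B_{G-e,\tau}(\varphi(f))$.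
   Context: All following notions are defined for any multigraph $H$ with vertex set $\{0\}\cup U$, $U$ a finite set of positive integers, with a ranking $\tau$ (a total order) of $U$; vertex $0$ is ranked before all of $U$. For vertices $a,b$, $\mu_H(a,b)$ is the number of edges joining them. For $I\subseteq U$ and $v\in I$, $\mathrm{outdeg}_{I,H}(v)$ is the number of edges $\{w,v\}$ of $H$ with $w\notin I$ (loops never counted). An $H$-parking function is $f:V(H)\to\mathbb{N}\cup\{ -1\}$ with $f(0)=-1$ such that every nonempty $I\subseteq U$ contains $v$ with $0\le f(v)<\mathrm{outdeg}_{I,H}(v)$; $\mathcal{P}_H$ is the set of them, and $w_H(f)=|E(H)|-|V(H)|-\sum_{x\in V(H)}f(x)$. For $f\in\mathcal{P}_H$, $\mathrm{Ord}_{H,\tau}(f)$ is produced by: set $val=f$, $P=\emptyset$, $Q=\{0\}$; repeatedly let $v$ be the element of $Q$ of smallest rank; for each vertex $w\notin P\cup Q$, if $0\le val(w)<\mu_H(w,v)$ add $w$ to $Q$, otherwise replace $val(w)$ by $val(w)-\mu_H(w,v)$; then move $v$ from $Q$ to $P$; continue until all vertices are in $P$. If $v_0=0,v_1,\dots,v_m$ is the order of entry into $P$, put $\mathrm{Ord}(f)_i=v_i$, $\mathrm{Rea}(f)(i)=f(v_i)$ ($1\le i\le m$). For $v\in U$ with $\mathrm{Ord}(f)_i=v$, let $I_v=\{\mathrm{Ord}(f)_j:j\ge i\}$; $v$ is $f$-critical if $f(v)=\mathrm{outdeg}_{I_v,H}(v)-1$. An $H$-parking function $g$ is weak $v$-identical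 to $f$ if (1) $\mathrm{Rea}(g)(j)=\mathrm{Rea}(f)(j)$ and $\mathrm{Ord}(g)_j=\mathrm{Ord}(f)_j$ for $1\le j\le i-1$; (2) $g(v)\ge f(v)$; (3) $g(w)\ge\mathrm{outdeg}_{I_v,H}(w)$ for all $w\in I_v$ with $\tau(w)<\tau(v)$; strong $v$-identical if moreover $\mathrm{Ord}(g)_i=v$. $W_{v,f},S_{v,f}$ are the sets of $H$-parking functions weak, resp. strong, $v$-identical to $f$. A vertex $v\in U$ is an $f$-bridge vertex if it is $f$-critical and $|W_{v,f}|=|S_{v,f}|$; $B_{H,\tau}(f)$ is the set of $f$-bridge vertices. -}

module Defs where

open import Data.Nat as ℕ using (ℕ; zero; suc)
open import Data.Integer as ℤ using (ℤ; +_; -[1+_])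
open import Data.Fin as Fin using (Fin; zero; suc; toℕ)
open import Data.Fin.Permutation using (Permutation′; _⟨$⟩ʳ_)
open import Data.Bool using (Bool; true; false; if_then_else_; _∧_; _∨_; not; T)
open import Data.List as List using (List; []; _∷_; _++_; take; drop; length)
open import Data.List.Relation.Unary.Unique.Propositional using (Unique)
open import Data.List.Membership.Propositional using (_∈_)
open import Data.Maybe using (Maybe; just; nothing)
open import Data.Vec as Vec using (Vec; lookup; _[_]%=_)
open import Data.Product using (Σ; _×_; _,_; ∃)
open import Relation.Nullary using (does)
open import Relation.Binary.PropositionalEquality using (_≡_; refl)
open import Data.Bool.Properties using (∨-comm; T?)
open import Function.Bundles using (_⇔_)

-- Multigraphs on the vertex set {0,1,...,n} = Fin (suc n); vertex 0 is
-- 'zero', vertex i ∈ [n] is 'suc (i-1)'.  mult a b = μ(a,b) = number of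
-- edges joining a and b (loops: mult a a).

record Multigraph (n : ℕ) : Set where
  field
    mult : Fin (suc n) → Fin (suc n) → ℕ
    sym  : ∀ a b → mult a b ≡ mult b a
open Multigraph public

sumFin : ∀ {m} → (Fin m → ℕ) → ℕ
sumFin {zero}  f = 0
sumFin {suc m} f = f zero ℕ.+ sumFin (λ i → f (suc i))

sumFinℤ : ∀ {m} → (Fin m → ℤ) → ℤ
sumFinℤ {zero}  f = + 0
sumFinℤ {suc m} f = f zero ℤ.+ sumFinℤ (λ i → f (suc i))

-- |E(H)| : each unordered pair {a,b} (a ≤ b, loops included) counted once
numEdges : ∀ {n} → Multigraph n → ℕ
numEdges H = sumFin (λ a → sumFin (λ b →
  if does (toℕ a ℕ.≤? toℕ b) then mult H a b else 0))

data Reach {n} (H : Multigraph n) : Fin (suc n) → Set where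
  here : Reach H zero
  step : ∀ {a b} → Reach H a → 1 ℕ.≤ mult H a b → Reach H b

Connected : ∀ {n} → Multigraph n → Set
Connected H = ∀ v → Reach H v

-- G - e, where e is an edge joining 0 and vertex suc u
deleteEdge : ∀ {n} → Multigraph n → Fin n → Multigraph n
deleteEdge {n} H u = record { mult = m ; sym = s }
  where
  isE : Fin (suc n) → Fin (suc n) → Bool
  isE a b = (does (a Fin.≟ zero) ∧ does (b Fin.≟ suc u))
          ∨ (does (b Fin.≟ zero) ∧ does (a Fin.≟ suc u))
  m : Fin (suc n) → Fin (suc n) → ℕ
  m a b = if isE a b then mult H a b ℕ.∸ 1 else mult H a b
  s : ∀ a b → m a b ≡ m b a
  s a b rewrite ∨-comm (does (a Fin.≟ zero) ∧ does (b Fin.≟ suc u))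
                        (does (b Fin.≟ zero) ∧ does (a Fin.≟ suc u))
              | Multigraph.sym H a b = refl

-- Rankings.  A vertex ranking τ of [n] is a permutation of Fin n
-- (position of vertex suc i is τ(i)); vertex 0 is ranked before all of U.

Ranking : ℕ → Set
Ranking n = Permutation′ n

rank : ∀ {n} → Ranking n → Fin (suc n) → ℕ
rank τ zero    = 0
rank τ (suc i) = suc (toℕ (τ ⟨$⟩ʳ i))

-- Functions V(H) → ℕ ∪ {-1} are represented as vectors of integers
-- (the range condition is part of being an H-parking function).

Fn : ℕ → Set
Fn n = Vec ℤ (suc n)

VSet : ℕ → Set
VSet n = Fin (suc n) → Bool

outdeg : ∀ {n} → Multigraph n → VSet n → Fin (suc n) → ℕ
outdeg H I v = sumFin (λ w → if I w then 0 else mult H w v)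

IsPF : ∀ {n} → Multigraph n → Fn n → Set
IsPF {n} H f =
    (lookup f zero ≡ -[1+ 0 ])
  × (∀ v → -[1+ 0 ] ℤ.≤ lookup f v)
  × (∀ (I : VSet n) → I zero ≡ false → (∃ λ x → I x ≡ true) →
       ∃ λ v → I v ≡ true × + 0 ℤ.≤ lookup f v × lookup f v ℤ.< + outdeg H I v)

weight : ∀ {n} → Multigraph n → Fn n → ℤ
weight {n} H f = (+ numEdges H ℤ.- + suc n) ℤ.- sumFinℤ (lookup f)

record OState (n : ℕ) : Set where
  constructor ostate
  field
    val : Fin (suc n) → ℤ
    inP : VSet n
    inQ : VSet n
    out : List (Fin (suc n))     -- vertices in order of entry into P

argminRank : ∀ {n} → Ranking n → List (Fin (suc n)) → Maybe (Fin (suc n))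
argminRank τ [] = nothing
argminRank τ (x ∷ xs) with argminRank τ xs
... | nothing = just x
... | just y  = if does (rank τ x ℕ.≤? rank τ y) then just x else just y

allV : ∀ n → List (Fin (suc n))
allV n = List.allFin (suc n)

ostep : ∀ {n} → Multigraph n → Ranking n → OState n → Maybe (OState n)
ostep {n} H τ (ostate val inP inQ out) with argminRank τ (List.filter (λ x → T? (inQ x)) (allV n))
... | nothing = nothing
... | just v  = just (ostate val′ inP′ inQ′ (out ++ v ∷ []))
  where
  outside : Fin (suc n) → Bool
  outside w = not (inP w) ∧ not (inQ w)
  joins : Fin (suc n) → Bool
  joins w = does (+ 0 ℤ.≤? val w) ∧ does (val w ℤ.<? + mult H w v)
  val′ : Fin (suc n) → ℤ
  val′ w = if outside w ∧ not (joins w) then val w ℤ.- + mult H w v else val w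
  inQ′ : VSet n
  inQ′ w = if does (w Fin.≟ v) then false else (inQ w ∨ (outside w ∧ joins w))
  inP′ : VSet n
  inP′ w = does (w Fin.≟ v) ∨ inP w

-- iterate with fuel; every iteration moves one vertex into P, so
-- |V(H)| = suc n iterations suffice
orun : ∀ {n} → Multigraph n → Ranking n → ℕ → OState n → OState n
orun H τ zero    s = s
orun H τ (suc k) s with ostep H τ s
... | nothing = s
... | just s′ = orun H τ k s′

-- Ord(f) as the list v₀ = 0, v₁, …, v_m (so Ord(f)_i is entry i)
Ord : ∀ {n} → Multigraph n → Ranking n → Fn n → List (Fin (suc n))
Ord {n} H τ f = OState.out (orun H τ (suc n)
  (ostate (lookup f) (λ _ → false) (λ x → does (x Fin.≟ zero)) []))

at : ∀ {A : Set} → List A → ℕ → Maybe A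
at []       _       = nothing
at (x ∷ xs) zero    = just x
at (x ∷ xs) (suc i) = at xs i

memb : ∀ {n} → List (Fin (suc n)) → VSet n
memb []       w = false
memb (x ∷ xs) w = does (w Fin.≟ x) ∨ memb xs w

-- I_v = {Ord(f)_j : j ≥ i}, where Ord(f)_i = v
Iset : ∀ {n} → Multigraph n → Ranking n → Fn n → ℕ → VSet n
Iset H τ f i = memb (drop i (Ord H τ f))

Critical : ∀ {n} → Multigraph n → Ranking n → Fn n → ℕ → Fin (suc n) → Set
Critical H τ f i v = lookup f v ≡ + outdeg H (Iset H τ f i) v ℤ.- + 1

WeakId : ∀ {n} → Multigraph n → Ranking n → Fn n → ℕ → Fin (suc n) → Fn n → Set
WeakId H τ f i v g =
    IsPF H g
  × take i (Ord H τ g) ≡ take i (Ord H τ f)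
  × List.map (lookup g) (take i (Ord H τ g)) ≡ List.map (lookup f) (take i (Ord H τ f))
  × lookup f v ℤ.≤ lookup g v
  × (∀ w → Iset H τ f i w ≡ true → rank τ w ℕ.< rank τ v →
       + outdeg H (Iset H τ f i) w ℤ.≤ lookup g w)

StrongId : ∀ {n} → Multigraph n → Ranking n → Fn n → ℕ → Fin (suc n) → Fn n → Set
StrongId H τ f i v g = WeakId H τ f i v g × at (Ord H τ g) i ≡ just v

HasCard : ∀ {n} → (Fn n → Set) → ℕ → Set
HasCard {n} P k = Σ (List (Fn n)) λ l →
  Unique l × (∀ g → (g ∈ l) ⇔ P g) × length l ≡ k

SameCard : ∀ {n} → (Fn n → Set) → (Fn n → Set) → Set
SameCard P Q = ∃ λ k → HasCard P k × HasCard Q k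

Bridge : ∀ {n} → Multigraph n → Ranking n → Fn n → Fin n → Set
Bridge H τ f u = ∃ λ i →
    at (Ord H τ f) i ≡ just (suc u)
  × Critical H τ f i (suc u)
  × SameCard (WeakId H τ f i (suc u)) (StrongId H τ f i (suc u))

φ : ∀ {n} → Fin n → Fn n → Fn n
φ u f = f [ suc u ]%= (λ x → x ℤ.- + 1)

module Submission where

-- Write δ for the indicator of u.  Deleting e lowers μ(0,x) and
-- every outdeg_I(x) with 0 ∉ I by δ(x), while φ lowers f(x) by δ(x); hence
-- every comparison between values and degrees that is invariant under adding
-- a constant is the same for (G, f) and (G-e, φ f).
--
-- Part (1) follows directly: the clauses of the parking condition transfer
-- one by one, ψ (raising the value at u) inverts φ, and |E| and Σ f both drop
-- by one.  For part (2) we unfold the ordering algorithm Ord and show: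
--   * for f ∈ P¹_G the runs of Ord on (G, f) and (G-e, φ f) agree step by
--     step (after the root, only edges away from the root matter), so
--     Ord_G(f) = Ord_{G-e}(φ f) and the sets I_v coincide;
--   * criticality and weak/strong v-identity then transfer along φ;
--   * every g weakly v-identical to f again lies in P¹_G: if g(u) = 0, then u
--     is processed right after the root (minimal rank), which contradicts one
--     of the three conditions of weak identity;
--   * so φ, ψ are inverse bijections between the weak (strong) identity sets,
--     which therefore have the same sizes on both sides.

open import Defs hiding (sym)
open import Data.Nat using (ℕ; suc; _≤_)
open import Data.Integer as ℤ using (+_; -[1+_])
open import Data.Fin using (Fin; zero; suc; toℕ)
open import Data.Vec using (lookup)
open import Data.Product using (_×_; ∃; _,_; proj₁; proj₂)
open import Relation.Binary.PropositionalEquality using (_≡_)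
open import Function.Bundles using (_⇔_; mk⇔; Equivalence)

open import Data.Nat as ℕ using (z≤n; s≤s; _+_; _<_)
import Data.Nat.Properties as ℕP
open import Data.Integer using (ℤ)
import Data.Integer.Properties as ℤP
open import Data.Integer.Tactic.RingSolver using (solve-∀)
open import Data.Fin.Properties using (_≟_; suc-injective; toℕ-injective; toℕ<n)
open import Data.Fin.Permutation using (_⟨$⟩ʳ_; _⟨$⟩ˡ_; inverseˡ)
open import Data.Vec using (Vec; _∷_; []; _[_]%=_)
open import Data.Vec.Properties using (lookup∘updateAt; lookup∘updateAt′; updateAt-updateAt; updateAt-id-local)
open import Data.Bool using (Bool; true; false; if_then_else_; _∧_; _∨_; not; T)
open import Data.Bool.Properties using (∧-zeroʳ; ∨-identityʳ; ∨-zeroʳ; ∨-conicalˡ; ∨-conicalʳ; T?; T-≡; T-not-≡)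
open import Data.List as List using (List; []; _∷_; _++_)
open import Data.Empty using (⊥; ⊥-elim)
open import Data.Sum using (_⊎_; inj₁; inj₂)
open import Data.Maybe using (just; nothing)
open import Data.List.Properties using (++-identityʳ; ++-assoc; filter-≐; length-map; ∷-injectiveˡ; ∷-injectiveʳ)
import Data.List.Relation.Unary.Unique.Propositional.Properties as Unique
open import Data.List.Relation.Unary.All using (All; []; _∷_)
open import Data.List.Relation.Unary.All.Properties using (drop⁺)
open import Data.List.Relation.Unary.Any using (here; there)
open import Data.List.Membership.Propositional using (_∈_)
open import Data.List.Membership.Propositional.Properties using (∈-filter⁺; ∈-filter⁻; ∈-allFin; ∈-map⁺; ∈-map⁻)
open import Relation.Nullary using (¬_; yes; no; does)
open import Relation.Nullary.Decidable using (dec-true; dec-false; does-⇔)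
open import Relation.Binary.PropositionalEquality
  using (refl; sym; trans; cong; cong₂; subst; subst₂; _≢_; module ≡-Reasoning)

sumFin-cong : ∀ {m} {f g : Fin m → ℕ} → (∀ i → f i ≡ g i) → sumFin f ≡ sumFin g
sumFin-cong {ℕ.zero} e = refl
sumFin-cong {suc m}  e = cong₂ _+_ (e zero) (sumFin-cong (λ i → e (suc i)))

sumFin-bump : ∀ {m} (f g : Fin m → ℕ) (i₀ : Fin m) {c : ℕ} → g i₀ ≡ f i₀ + c →
              (∀ j → j ≢ i₀ → g j ≡ f j) → sumFin g ≡ sumFin f + c
sumFin-bump {suc m} f g zero {c} e rest = begin
  g zero + sumFin (λ i → g (suc i))   ≡⟨ cong₂ _+_ e (sumFin-cong (λ i → rest (suc i) λ ())) ⟩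
  (f zero + c) + sumFin (λ i → f (suc i)) ≡⟨ ℕP.+-assoc (f zero) c _ ⟩
  f zero + (c + sumFin (λ i → f (suc i))) ≡⟨ cong (λ z → f zero + z) (ℕP.+-comm c _) ⟩
  f zero + (sumFin (λ i → f (suc i)) + c) ≡⟨ ℕP.+-assoc (f zero) _ c ⟨
  (f zero + sumFin (λ i → f (suc i))) + c ∎
  where open ≡-Reasoning
sumFin-bump {suc m} f g (suc i₀) {c} e rest = begin
  g zero + sumFin (λ i → g (suc i))   ≡⟨ cong₂ _+_ (rest zero λ ()) tail ⟩
  f zero + (sumFin (λ i → f (suc i)) + c) ≡⟨ ℕP.+-assoc (f zero) _ c ⟨
  (f zero + sumFin (λ i → f (suc i))) + c ∎
  where
  open ≡-Reasoning
  tail : sumFin (λ i → g (suc i)) ≡ sumFin (λ i → f (suc i)) + c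
  tail = sumFin-bump (λ i → f (suc i)) (λ i → g (suc i)) i₀ e
           (λ j j≢i₀ → rest (suc j) (λ e′ → j≢i₀ (suc-injective e′)))

sumFin-elem : ∀ {m} (f : Fin m → ℕ) i → f i ≤ sumFin f
sumFin-elem f zero    = ℕP.m≤m+n _ _
sumFin-elem f (suc i) = ℕP.≤-trans (sumFin-elem (λ j → f (suc j)) i) (ℕP.m≤n+m _ (f zero))

sumFin-zero : ∀ {m} → sumFin {m} (λ _ → 0) ≡ 0
sumFin-zero {ℕ.zero} = refl
sumFin-zero {suc m}  = sumFin-zero {m}

sumFin-ones : ∀ m → sumFin {m} (λ _ → 1) ≡ m
sumFin-ones ℕ.zero  = refl
sumFin-ones (suc m) = cong suc (sumFin-ones m)

sumFinℤ-dec : ∀ {m} (xs : Vec ℤ m) (i : Fin m) →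
              sumFinℤ (lookup (xs [ i ]%= (λ x → x ℤ.- + 1))) ℤ.+ + 1 ≡ sumFinℤ (lookup xs)
sumFinℤ-dec (x ∷ xs) zero = regroup x (sumFinℤ (lookup xs))
  where
  regroup : ∀ (a b : ℤ) → ((a ℤ.- + 1) ℤ.+ b) ℤ.+ + 1 ≡ a ℤ.+ b
  regroup = solve-∀
sumFinℤ-dec (x ∷ xs) (suc i) =
  trans (ℤP.+-assoc x _ (+ 1)) (cong (λ z → x ℤ.+ z) (sumFinℤ-dec xs i))

-- Every relation on ℤ that is invariant under adding a
-- constant (≡, ≤, <) is also reflected by it; this is the only arithmetic
-- fact behind the comparison of f with φ(f) below.

RespectsShift : (ℤ → ℤ → Set) → Set
RespectsShift _R_ = ∀ (c : ℤ) {x y} → x R y → (x ℤ.+ c) R (y ℤ.+ c)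

shift⇔ : ∀ {_R_ : ℤ → ℤ → Set} → RespectsShift _R_ →
         ∀ (c : ℤ) {x y : ℤ} → ((x ℤ.+ c) R (y ℤ.+ c)) ⇔ (x R y)
shift⇔ {_R_} mono c {x} {y} = mk⇔ cancel (mono c)
  where
  undo : ∀ (a b : ℤ) → (a ℤ.+ b) ℤ.+ ℤ.- b ≡ a
  undo = solve-∀
  cancel : (x ℤ.+ c) R (y ℤ.+ c) → x R y
  cancel p = subst₂ _R_ (undo x c) (undo y c) (mono (ℤ.- c) p)

dec-inc : ∀ (a : ℤ) → (a ℤ.- + 1) ℤ.+ + 1 ≡ a
dec-inc = solve-∀

inc-dec : ∀ (a : ℤ) → (a ℤ.+ + 1) ℤ.- + 1 ≡ a
inc-dec = solve-∀

shift-≡ : RespectsShift _≡_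
shift-≡ c = cong (λ z → z ℤ.+ c)

shift-≤ : RespectsShift ℤ._≤_
shift-≤ c = ℤP.+-monoˡ-≤ c

shift-< : RespectsShift ℤ._<_
shift-< c = ℤP.+-monoˡ-< c

HasCard-transport : ∀ {n} {P Q : Fn n → Set} (F B : Fn n → Fn n) →
                    (∀ g → B (F g) ≡ g) → (∀ h → F (B h) ≡ h) →
                    (∀ g → P g → Q (F g)) → (∀ h → Q h → P (B h)) →
                    ∀ {k} → HasCard P k → HasCard Q k
HasCard-transport {P = P} {Q} F B BF FB PQ QP (l , unique , members , size) =
  List.map F l , Unique.map⁺ F-injective unique , (λ h → mk⇔ (image h) (preimage h))
  , trans (length-map F l) size
  where
  F-injective : ∀ {x y} → F x ≡ F y → x ≡ y
  F-injective {x} {y} e = trans (sym (BF x)) (trans (cong B e) (BF y))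
  image : ∀ h → h ∈ List.map F l → Q h
  image h h∈ with ∈-map⁻ F h∈
  ... | g , g∈l , refl = PQ g (Equivalence.to (members g) g∈l)
  preimage : ∀ h → Q h → h ∈ List.map F l
  preimage h Qh = subst (_∈ List.map F l) (FB h) (∈-map⁺ F (Equivalence.from (members (B h)) (QP h Qh)))

SameCard-transport : ∀ {n} {P P′ Q Q′ : Fn n → Set} (F B : Fn n → Fn n) →
                     (∀ g → B (F g) ≡ g) → (∀ h → F (B h) ≡ h) →
                     (∀ g → P g → Q (F g)) → (∀ h → Q h → P (B h)) →
                     (∀ g → P′ g → Q′ (F g)) → (∀ h → Q′ h → P′ (B h)) →
                     SameCard P P′ → SameCard Q Q′
SameCard-transport F B BF FB PQ QP P′Q′ Q′P′ (k , cardP , cardP′) =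
  k , HasCard-transport F B BF FB PQ QP cardP , HasCard-transport F B BF FB P′Q′ Q′P′ cardP′

≟⇒≡ : ∀ {m} {a b : Fin m} → does (a ≟ b) ≡ true → a ≡ b
≟⇒≡ {a = a} {b} e with a ≟ b | e
... | yes a≡b | _ = a≡b
... | no _    | ()

-- A parking function is nonnegative off the root: apply the defining
-- condition to the singleton {x}.

pf-nonneg : ∀ {m} (H : Multigraph m) (h : Fn m) → IsPF H h → ∀ x → x ≢ zero → + 0 ℤ.≤ lookup h x
pf-nonneg H h (_ , _ , burn) x x≢0
  with burn (λ w → does (w ≟ x)) (dec-false (zero ≟ x) (λ e → x≢0 (sym e))) (x , dec-true (x ≟ x) refl)
... | v , v∈I , 0≤hv , _ = subst (λ z → + 0 ℤ.≤ lookup h z) (≟⇒≡ v∈I) 0≤hv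

pf-lower : ∀ {m} (h : Fn m) → lookup h zero ≡ -[1+ 0 ] → (∀ x → x ≢ zero → + 0 ℤ.≤ lookup h x) →
           ∀ x → -[1+ 0 ] ℤ.≤ lookup h x
pf-lower h h0 nonneg zero    = subst (-[1+ 0 ] ℤ.≤_) (sym h0) ℤP.≤-refl
pf-lower h h0 nonneg (suc x) = ℤP.≤-trans ℤ.-≤+ (nonneg (suc x) (λ ()))

root-edges-≤-outdeg : ∀ {m} (H : Multigraph m) (I : VSet m) x → I zero ≡ false → mult H zero x ≤ outdeg H I x
root-edges-≤-outdeg H I x I0 rewrite I0 = ℕP.m≤m+n _ _

member-≢root : ∀ {m} {I : VSet m} {v} → I zero ≡ false → I v ≡ true → v ≢ zero
member-≢root I0 Iv refl with trans (sym I0) Iv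
... | ()

module Deletion {n : ℕ} (G : Multigraph n) (u : Fin n) (hu : 1 ≤ mult G zero (suc u)) where

  D : Multigraph n
  D = deleteEdge G u

  δ : Fin (suc n) → ℕ
  δ x = if does (x ≟ suc u) then 1 else 0

  δ-endpoint : δ (suc u) ≡ 1
  δ-endpoint = cong (if_then 1 else 0) (dec-true (suc u ≟ suc u) refl)

  δ-other : ∀ {x} → x ≢ suc u → δ x ≡ 0
  δ-other {x} x≢u = cong (if_then 1 else 0) (dec-false (x ≟ suc u) x≢u)

  mult-root : ∀ x → mult G zero x ≡ mult D zero x + δ x
  mult-root x rewrite ∧-zeroʳ (does (x ≟ zero)) | ∨-identityʳ (does (x ≟ suc u)) with x ≟ suc u
  ... | yes refl = sym (ℕP.m∸n+n≡m hu)
  ... | no _     = sym (ℕP.+-identityʳ _)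

  mult-off-root : ∀ w x → w ≢ zero → x ≢ zero → mult D w x ≡ mult G w x
  mult-off-root zero    _       w≢0 _   = ⊥-elim (w≢0 refl)
  mult-off-root (suc w) zero    _   x≢0 = ⊥-elim (x≢0 refl)
  mult-off-root (suc w) (suc x) _   _   = refl

  outdeg-del : ∀ I x → I zero ≡ false → x ≢ zero → outdeg G I x ≡ outdeg D I x + δ x
  outdeg-del I x I0 x≢0 = sumFin-bump _ _ zero root other
    where
    root : (if I zero then 0 else mult G zero x) ≡ (if I zero then 0 else mult D zero x) + δ x
    root rewrite I0 = mult-root x
    other : ∀ w → w ≢ zero →
            (if I w then 0 else mult G w x) ≡ (if I w then 0 else mult D w x)
    other w w≢0 = cong (if I w then 0 else_) (sym (mult-off-root w x w≢0 x≢0))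

  numEdges-del : numEdges G ≡ suc (numEdges D)
  numEdges-del = trans (sumFin-bump (row D) (row G) zero rowRoot rowOther) (ℕP.+-comm _ 1)
    where
    row : Multigraph n → Fin (suc n) → ℕ
    row H a = sumFin (λ b → if does (toℕ a ℕ.≤? toℕ b) then mult H a b else 0)
    rowRoot : row G zero ≡ row D zero + 1
    rowRoot = sumFin-bump _ _ (suc u) (trans (mult-root (suc u)) (cong (λ k → mult D zero (suc u) + k) δ-endpoint))
                (λ b b≢u → trans (mult-root b)
                             (trans (cong (λ k → mult D zero b + k) (δ-other b≢u)) (ℕP.+-identityʳ _)))
    rowOther : ∀ a → a ≢ zero → row G a ≡ row D a
    rowOther zero    a≢0 = ⊥-elim (a≢0 refl)
    rowOther (suc a) _   = sumFin-cong entry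
      where
      entry : ∀ b → (if does (toℕ (suc a) ℕ.≤? toℕ b) then mult G (suc a) b else 0)
                  ≡ (if does (toℕ (suc a) ℕ.≤? toℕ b) then mult D (suc a) b else 0)
      entry zero    = refl
      entry (suc b) = refl

  lookup-φ : ∀ f x → lookup f x ≡ lookup (φ u f) x ℤ.+ + δ x
  lookup-φ f x with x ≟ suc u
  ... | yes refl rewrite lookup∘updateAt (suc u) {λ z → z ℤ.- + 1} f = sym (dec-inc (lookup f (suc u)))
  ... | no x≢u rewrite lookup∘updateAt′ x (suc u) {λ z → z ℤ.- + 1} x≢u f =
    sym (ℤP.+-identityʳ (lookup f x))

  ψ : Fn n → Fn n
  ψ h = h [ suc u ]%= (λ z → z ℤ.+ + 1)

  φ∘ψ : ∀ h → φ u (ψ h) ≡ h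
  φ∘ψ h = trans (updateAt-updateAt (suc u) h) (updateAt-id-local (suc u) h (inc-dec (lookup h (suc u))))

  ψ∘φ : ∀ f → ψ (φ u f) ≡ f
  ψ∘φ f = trans (updateAt-updateAt (suc u) f) (updateAt-id-local (suc u) f (dec-inc (lookup f (suc u))))

  φ-injective : ∀ f g → φ u f ≡ φ u g → f ≡ g
  φ-injective f g φf≡φg = trans (sym (ψ∘φ f)) (trans (cong ψ φf≡φg) (ψ∘φ g))

  values-transfer : ∀ {_R_ : ℤ → ℤ → Set} → RespectsShift _R_ → ∀ f g x →
                    (lookup f x R lookup g x) ⇔ (lookup (φ u f) x R lookup (φ u g) x)
  values-transfer {_R_} mono f g x =
    subst₂ (λ a b → (a R b) ⇔ (lookup (φ u f) x R lookup (φ u g) x))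
      (sym (lookup-φ f x)) (sym (lookup-φ g x)) (shift⇔ mono (+ δ x))

  -- k turns a degree into a threshold and commutes with adding constants
  Shifting : (ℕ → ℤ) → Set
  Shifting k = ∀ d c → k (d + c) ≡ k d ℤ.+ + c

  degree-transfer : ∀ {_R_ : ℤ → ℤ → Set} → RespectsShift _R_ → ∀ {k} → Shifting k →
                    ∀ f I x → I zero ≡ false → x ≢ zero →
                    (lookup f x R k (outdeg G I x)) ⇔ (lookup (φ u f) x R k (outdeg D I x))
  degree-transfer {_R_} mono {k} k-shift f I x I0 x≢0 =
    subst₂ (λ a b → (a R b) ⇔ (lookup (φ u f) x R k (outdeg D I x))) (sym (lookup-φ f x))
      (sym (trans (cong k (outdeg-del I x I0 x≢0)) (k-shift _ _))) (shift⇔ mono (+ δ x))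

  nonneg-transfer : ∀ f x → (+ δ x ℤ.≤ lookup f x) ⇔ (+ 0 ℤ.≤ lookup (φ u f) x)
  nonneg-transfer f x =
    subst (λ a → (+ δ x ℤ.≤ a) ⇔ (+ 0 ℤ.≤ lookup (φ u f) x)) (sym (lookup-φ f x)) (shift⇔ shift-≤ (+ δ x))

  root-φ : ∀ f → lookup (φ u f) zero ≡ lookup f zero
  root-φ f = lookup∘updateAt′ zero (suc u) (λ ()) f

  -- f(x) ≥ δ(x) off the root; for f ∈ P¹_G this says f(u) ≥ 1 and f ≥ 0.
  AboveDelta : Fn n → Set
  AboveDelta f = ∀ x → x ≢ zero → + δ x ℤ.≤ lookup f x

  0≤δ : ∀ x → + 0 ℤ.≤ + δ x
  0≤δ x = ℤ.+≤+ z≤n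

  P¹-above : ∀ f → IsPF G f → + 1 ℤ.≤ lookup f (suc u) → AboveDelta f
  P¹-above f pf f1 x x≢0 with x ≟ suc u
  ... | yes refl = f1
  ... | no _     = pf-nonneg G f pf x x≢0

  φ-PF-above : ∀ f → IsPF D (φ u f) → AboveDelta f
  φ-PF-above f pf x x≢0 = Equivalence.from (nonneg-transfer f x) (pf-nonneg D (φ u f) pf x x≢0)

  burns-transfer : ∀ f (I : VSet n) → I zero ≡ false → AboveDelta f →
                   (∃ λ v → I v ≡ true × + 0 ℤ.≤ lookup f v × lookup f v ℤ.< + outdeg G I v) ⇔
                   (∃ λ v → I v ≡ true × + 0 ℤ.≤ lookup (φ u f) v × lookup (φ u f) v ℤ.< + outdeg D I v)
  burns-transfer f I I0 above = mk⇔
    (λ (v , Iv , _ , bound) → v , Iv , Equivalence.to (nonneg-transfer f v) (above v (v≢0 Iv))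
                            , Equivalence.to (bound-transfer v (v≢0 Iv)) bound)
    (λ (v , Iv , _ , bound) → v , Iv , ℤP.≤-trans (0≤δ v) (above v (v≢0 Iv))
                            , Equivalence.from (bound-transfer v (v≢0 Iv)) bound)
    where
    v≢0 : ∀ {v} → I v ≡ true → v ≢ zero
    v≢0 = member-≢root {I = I} I0
    bound-transfer : ∀ v → v ≢ zero →
                     (lookup f v ℤ.< + outdeg G I v) ⇔ (lookup (φ u f) v ℤ.< + outdeg D I v)
    bound-transfer v = degree-transfer shift-< {+_} (λ _ _ → refl) f I v I0

  φ-preserves-PF : ∀ f → IsPF G f → + 1 ℤ.≤ lookup f (suc u) → IsPF D (φ u f)
  φ-preserves-PF f pf f1 =
    root , pf-lower (φ u f) root nonneg
    , λ I I0 nonempty → Equivalence.to (burns-transfer f I I0 (P¹-above f pf f1)) (proj₂ (proj₂ pf) I I0 nonempty)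
    where
    root : lookup (φ u f) zero ≡ -[1+ 0 ]
    root = trans (root-φ f) (proj₁ pf)
    nonneg : ∀ x → x ≢ zero → + 0 ℤ.≤ lookup (φ u f) x
    nonneg x x≢0 = Equivalence.to (nonneg-transfer f x) (P¹-above f pf f1 x x≢0)

  φ-reflects-PF : ∀ f → IsPF D (φ u f) → IsPF G f
  φ-reflects-PF f pf =
    root , pf-lower f root nonneg
    , λ I I0 nonempty → Equivalence.from (burns-transfer f I I0 (φ-PF-above f pf)) (proj₂ (proj₂ pf) I I0 nonempty)
    where
    root : lookup f zero ≡ -[1+ 0 ]
    root = trans (sym (root-φ f)) (proj₁ pf)
    nonneg : ∀ x → x ≢ zero → + 0 ℤ.≤ lookup f x
    nonneg x x≢0 = ℤP.≤-trans (0≤δ x) (φ-PF-above f pf x x≢0)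

  φ-reflects-positive : ∀ f → IsPF D (φ u f) → + 1 ℤ.≤ lookup f (suc u)
  φ-reflects-positive f pf = subst (λ d → + d ℤ.≤ lookup f (suc u)) δ-endpoint (φ-PF-above f pf (suc u) (λ ()))

  pf-φ⇔ : ∀ f → (IsPF G f × + 1 ℤ.≤ lookup f (suc u)) ⇔ IsPF D (φ u f)
  pf-φ⇔ f = mk⇔ (λ (pf , f1) → φ-preserves-PF f pf f1) (λ pf → φ-reflects-PF f pf , φ-reflects-positive f pf)

  φ-onto : ∀ g → IsPF D g → ∃ λ f → IsPF G f × + 1 ℤ.≤ lookup f (suc u) × φ u f ≡ g
  φ-onto g pfg = ψ g , φ-reflects-PF (ψ g) pfψ , φ-reflects-positive (ψ g) pfψ , φ∘ψ g
    where
    pfψ : IsPF D (φ u (ψ g))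
    pfψ = subst (IsPF D) (sym (φ∘ψ g)) pfg

  -- φ preserves the weight: |E| and Σ f both drop by one.
  weight-φ : ∀ f → weight D (φ u f) ≡ weight G f
  weight-φ f = trans (regroup (+ numEdges D) (+ suc n) (sumFinℤ (lookup (φ u f))))
                     (cong₂ (λ E S → (+ E ℤ.- + suc n) ℤ.- S) (sym numEdges-del) (sumFinℤ-dec f (suc u)))
    where
    regroup : ∀ (E C S : ℤ) → (E ℤ.- C) ℤ.- S ≡ ((+ 1 ℤ.+ E) ℤ.- C) ℤ.- (S ℤ.+ + 1)
    regroup = solve-∀

memb-++ˡ : ∀ {n} (xs ys : List (Fin (suc n))) {w} → memb xs w ≡ true → memb (xs ++ ys) w ≡ true
memb-++ˡ (x ∷ xs) ys {w} e with does (w ≟ x)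
... | true  = refl
... | false = memb-++ˡ xs ys e

memb-++ʳ : ∀ {n} (xs ys : List (Fin (suc n))) {w} → memb ys w ≡ true → memb (xs ++ ys) w ≡ true
memb-++ʳ []       ys e = e
memb-++ʳ (x ∷ xs) ys {w} e with does (w ≟ x)
... | true  = refl
... | false = memb-++ʳ xs ys e

memb-singleton : ∀ {n} (v : Fin (suc n)) → memb (v ∷ []) v ≡ true
memb-singleton v rewrite dec-true (v ≟ v) refl = refl

memb-avoids : ∀ {n w} (L : List (Fin (suc n))) → All (_≢ w) L → memb L w ≡ false
memb-avoids []      []          = refl
memb-avoids {w = w} (x ∷ L) (x≢w ∷ rest) rewrite dec-false (w ≟ x) (λ e → x≢w (sym e)) = memb-avoids L rest

first-two : ∀ {A : Set} (L : List A) {x y} → at L 0 ≡ just x → at L 1 ≡ just y → ∃ λ R → L ≡ x ∷ y ∷ R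
first-two []          ()   _
first-two (a ∷ [])     _    ()
first-two (a ∷ b ∷ R) refl refl = R , refl

rank-injective : ∀ {n} (τ : Ranking n) {a b} → rank τ a ≡ rank τ b → a ≡ b
rank-injective τ {zero}  {zero}  _ = refl
rank-injective τ {suc a} {suc b} e = cong suc (begin
  a                         ≡⟨ inverseˡ τ ⟨
  τ ⟨$⟩ˡ (τ ⟨$⟩ʳ a)         ≡⟨ cong (τ ⟨$⟩ˡ_) (toℕ-injective (ℕP.suc-injective e)) ⟩
  τ ⟨$⟩ˡ (τ ⟨$⟩ʳ b)         ≡⟨ inverseˡ τ ⟩
  b                         ∎)
  where open ≡-Reasoning

argmin-nothing : ∀ {n} (τ : Ranking n) l → argminRank τ l ≡ nothing → l ≡ []
argmin-nothing τ []       _ = refl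
argmin-nothing τ (x ∷ xs) e with argminRank τ xs
argmin-nothing τ (x ∷ xs) () | nothing
argmin-nothing τ (x ∷ xs) e  | just y with rank τ x ℕ.≤ᵇ rank τ y
argmin-nothing τ (x ∷ xs) () | just y | true
argmin-nothing τ (x ∷ xs) () | just y | false

argmin-just : ∀ {n} (τ : Ranking n) l y → argminRank τ l ≡ just y →
              y ∈ l × (∀ x → x ∈ l → rank τ y ≤ rank τ x)
argmin-just τ (x ∷ xs) y e with argminRank τ xs in eq
argmin-just τ (x ∷ xs) .x refl | nothing rewrite argmin-nothing τ xs eq =
  here refl , λ { _ (here refl) → ℕP.≤-refl }
argmin-just τ (x ∷ xs) y e | just z with rank τ x ℕ.≤ᵇ rank τ z in x≤ᵇz | argmin-just τ xs z eq
argmin-just τ (x ∷ xs) .x refl | just z | true | _ , z-min =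
  here refl , λ { _ (here refl) → ℕP.≤-refl ; w (there w∈xs) → ℕP.≤-trans x≤z (z-min w w∈xs) }
  where
  x≤z : rank τ x ≤ rank τ z
  x≤z = ℕP.≤ᵇ⇒≤ (rank τ x) (rank τ z) (Equivalence.from T-≡ x≤ᵇz)
argmin-just τ (x ∷ xs) .z refl | just z | false | z∈xs , z-min =
  there z∈xs , λ { _ (here refl) → ℕP.<⇒≤ (ℕP.≰⇒> x≰z) ; w (there w∈xs) → z-min w w∈xs }
  where
  x≰z : ¬ (rank τ x ≤ rank τ z)
  x≰z x≤z with trans (sym (Equivalence.to T-≡ (ℕP.≤⇒≤ᵇ x≤z))) x≤ᵇz
  ... | ()

-- Joining the queue: a vertex with current value x enters Q when a
-- neighbour joined to it by m edges is processed.

Joins : ℤ → ℕ → Bool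
Joins x m = does (+ 0 ℤ.≤? x) ∧ does (x ℤ.<? + m)

Joins-true : ∀ x m → (Joins x m ≡ true) ⇔ (+ 0 ℤ.≤ x × x ℤ.< + m)
Joins-true x m = mk⇔ split (λ (0≤x , x<m) → cong₂ _∧_ (dec-true (+ 0 ℤ.≤? x) 0≤x) (dec-true (x ℤ.<? + m) x<m))
  where
  split : Joins x m ≡ true → + 0 ℤ.≤ x × x ℤ.< + m
  split e with + 0 ℤ.≤? x | x ℤ.<? + m | e
  ... | yes 0≤x | yes x<m | _ = 0≤x , x<m
  ... | yes _   | no _    | ()
  ... | no _    | _       | ()

Joins-false : ∀ x m → Joins x m ≡ false → + 0 ℤ.≤ x → + 0 ℤ.≤ x ℤ.- + m
Joins-false x m e 0≤x with + 0 ℤ.≤? x | x ℤ.<? + m | e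
... | yes _  | no x≮m | _  = ℤP.i≤j⇒0≤j-i (ℤP.≮⇒≥ x≮m)
... | no 0≰x | _      | _  = ⊥-elim (0≰x 0≤x)
... | yes _  | yes _  | ()

Joins-shift : ∀ y m c → + 0 ℤ.≤ y → Joins (y ℤ.+ + c) (m + c) ≡ Joins y m
Joins-shift y m c 0≤y = cong₂ _∧_
  (does-⇔ (mk⇔ (λ _ → 0≤y) (λ _ → ℤP.+-mono-≤ 0≤y (ℤ.+≤+ z≤n))) (+ 0 ℤ.≤? y ℤ.+ + c) (+ 0 ℤ.≤? y))
  (does-⇔ (shift⇔ shift-< (+ c)) (y ℤ.+ + c ℤ.<? + (m + c)) (y ℤ.<? + m))

module Ordering {n : ℕ} (H : Multigraph n) (τ : Ranking n) where
  open OState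

  queue : OState n → List (Fin (suc n))
  queue s = List.filter (λ x → T? (inQ s x)) (allV n)

  outside : OState n → Fin (suc n) → Bool
  outside s w = not (inP s w) ∧ not (inQ s w)

  process : OState n → Fin (suc n) → OState n
  process s v = ostate
    (λ w → if outside s w ∧ not (Joins (val s w) (mult H w v)) then val s w ℤ.- + mult H w v else val s w)
    (λ w → does (w ≟ v) ∨ inP s w)
    (λ w → if does (w ≟ v) then false else (inQ s w ∨ (outside s w ∧ Joins (val s w) (mult H w v))))
    (out s ++ v ∷ [])

  run-stuck : ∀ k s → argminRank τ (queue s) ≡ nothing → orun H τ k s ≡ s
  run-stuck ℕ.zero    s          _ = refl
  run-stuck (suc k) (ostate val inP inQ out) e with argminRank τ (queue (ostate val inP inQ out)) | e
  ... | nothing | _ = refl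

  run-step : ∀ k s v → argminRank τ (queue s) ≡ just v → orun H τ (suc k) s ≡ orun H τ k (process s v)
  run-step k (ostate val inP inQ out) v e with argminRank τ (queue (ostate val inP inQ out)) | e
  ... | just .v | refl = refl

  chosen-queued : ∀ s {v} → argminRank τ (queue s) ≡ just v → inQ s v ≡ true
  chosen-queued s e = Equivalence.to T-≡
    (proj₂ (∈-filter⁻ (λ x → T? (inQ s x)) {xs = allV n} (proj₁ (argmin-just τ _ _ e))))

  queued-∈ : ∀ s {v} → inQ s v ≡ true → v ∈ queue s
  queued-∈ s {v} e = ∈-filter⁺ (λ x → T? (inQ s x)) (∈-allFin v) (Equivalence.from T-≡ e)

  process-inP-self : ∀ s v → inP (process s v) v ≡ true
  process-inP-self s v rewrite dec-true (v ≟ v) refl = refl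

  process-inP-other : ∀ s v {w} → w ≢ v → inP (process s v) w ≡ inP s w
  process-inP-other s v {w} w≢v rewrite dec-false (w ≟ v) w≢v = refl

  process-inQ-other : ∀ s v {w} → w ≢ v →
                      inQ (process s v) w ≡ (inQ s w ∨ (outside s w ∧ Joins (val s w) (mult H w v)))
  process-inQ-other s v {w} w≢v rewrite dec-false (w ≟ v) w≢v = refl

  process-val : ∀ s v {w} → inP s w ≡ false → inQ s w ≡ false → Joins (val s w) (mult H w v) ≡ false →
                val (process s v) w ≡ val s w ℤ.- + mult H w v
  process-val s v pw qw jw rewrite pw | qw | jw = refl

  outside⇔ : ∀ s w → outside s w ≡ true ⇔ (inP s w ≡ false × inQ s w ≡ false)
  outside⇔ s w = mk⇔ split (λ (pw , qw) → cong₂ (λ p q → not p ∧ not q) pw qw)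
    where
    split : outside s w ≡ true → inP s w ≡ false × inQ s w ≡ false
    split o with inP s w | inQ s w | o
    ... | false | false | _ = refl , refl

  stayed-outside : ∀ s v w → inP (process s v) w ≡ false → inQ (process s v) w ≡ false →
                   inP s w ≡ false × inQ s w ≡ false × Joins (val s w) (mult H w v) ≡ false
  stayed-outside s v w pw′ qw′ with w ≟ v
  stayed-outside s v w ()  _     | yes refl
  stayed-outside s v w pw  stays | no _ = pw , qw
    , subst (λ o → o ∧ Joins (val s w) (mult H w v) ≡ false) (Equivalence.from (outside⇔ s w) (pw , qw))
        (∨-conicalʳ _ _ stays)
    where
    qw : inQ s w ≡ false
    qw = ∨-conicalˡ _ _ stays

  RootDone : OState n → Set
  RootDone s = inP s zero ≡ true × inQ s zero ≡ false

  chosen-≢root : ∀ s {v} → RootDone s → argminRank τ (queue s) ≡ just v → v ≢ zero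
  chosen-≢root s (_ , q0) e refl with trans (sym q0) (chosen-queued s e)
  ... | ()

  process-RootDone : ∀ s v → RootDone s → v ≢ zero → RootDone (process s v)
  process-RootDone s v (p0 , q0) v≢0 = p0′ , q0′
    where
    p0′ : inP (process s v) zero ≡ true
    p0′ rewrite p0 = ∨-zeroʳ _
    q0′ : inQ (process s v) zero ≡ false
    q0′ rewrite process-inQ-other s v (λ e → v≢0 (sym e)) | p0 | q0 = refl

  run-extends : ∀ k s → RootDone s → ∃ λ R → out (orun H τ k s) ≡ out s ++ R × All (_≢ zero) R
  run-extends ℕ.zero s _ = [] , sym (++-identityʳ _) , []
  run-extends (suc k) s done = by-choice (argminRank τ (queue s)) refl
    where
    by-choice : ∀ c → argminRank τ (queue s) ≡ c → ∃ λ R → out (orun H τ (suc k) s) ≡ out s ++ R × All (_≢ zero) R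
    by-choice nothing  e = [] , trans (cong out (run-stuck (suc k) s e)) (sym (++-identityʳ _)) , []
    by-choice (just v) e with run-extends k (process s v) (process-RootDone s v done (chosen-≢root s done e))
    ... | R , extends , R≢0 = v ∷ R
        , trans (cong out (run-step k s v e)) (trans extends (++-assoc (out s) (v ∷ []) R))
        , chosen-≢root s done e ∷ R≢0

  start : Fn n → OState n
  start f = ostate (lookup f) (λ _ → false) (λ x → does (x ≟ zero)) []

  afterRoot : Fn n → OState n
  afterRoot f = process (start f) zero

  Ord-afterRoot : ∀ f → Ord H τ f ≡ out (orun H τ n (afterRoot f))
  Ord-afterRoot f = cong out (run-step n (start f) zero (cong (λ l → argminRank τ (zero ∷ l)) (no-root (λ i → i))))
    where
    no-root : ∀ {m} (h : Fin m → Fin n) → List.filter (λ x → T? (does (x ≟ zero))) (List.tabulate (λ i → suc (h i))) ≡ []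
    no-root {ℕ.zero} h = refl
    no-root {suc m}  h = no-root (λ i → h (suc i))

  afterRoot-queue : ∀ f y → y ≢ zero → inQ (afterRoot f) y ≡ Joins (lookup f y) (mult H y zero)
  afterRoot-queue f y y≢0 rewrite dec-false (y ≟ zero) y≢0 = refl

  ord-shape : ∀ f → ∃ λ R → Ord H τ f ≡ zero ∷ R × All (_≢ zero) R
  ord-shape f with run-extends n (afterRoot f) (refl , refl)
  ... | R , extends , R≢0 = R , trans (Ord-afterRoot f) extends , R≢0

  Ord-head : ∀ f → at (Ord H τ f) 0 ≡ just zero
  Ord-head f with ord-shape f
  ... | R , shape , _ = cong (λ L → at L 0) shape

  root-not-later : ∀ f j → Iset H τ f (suc j) zero ≡ false
  root-not-later f j with ord-shape f
  ... | R , shape , R≢0 rewrite shape = memb-avoids (List.drop j R) (drop⁺ j R≢0)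

  second-entry : ∀ f → 1 ≤ n → at (Ord H τ f) 1 ≡ argminRank τ (queue (afterRoot f))
  second-entry f 1≤n = trans (cong (λ L → at L 1) (Ord-afterRoot f)) (go n 1≤n)
    where
    go : ∀ k → 1 ≤ k → at (out (orun H τ k (afterRoot f))) 1 ≡ argminRank τ (queue (afterRoot f))
    go (suc k) _ = by-choice (argminRank τ (queue (afterRoot f))) refl
      where
      by-choice : ∀ c → argminRank τ (queue (afterRoot f)) ≡ c → at (out (orun H τ (suc k) (afterRoot f))) 1 ≡ c
      by-choice nothing  e = cong (λ s → at (out s) 1) (run-stuck (suc k) (afterRoot f) e)
      by-choice (just v) e
        with run-extends k (process (afterRoot f) v)
               (process-RootDone (afterRoot f) v (refl , refl) (chosen-≢root (afterRoot f) (refl , refl) e))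
      ... | R , extends , _ = cong (λ L → at L 1) (trans (cong out (run-step k (afterRoot f) v e)) extends)

  empty-queue : ∀ s → argminRank τ (queue s) ≡ nothing → ∀ w → inQ s w ≡ false
  empty-queue s e w with inQ s w in qw
  ... | false = refl
  ... | true with subst (w ∈_) (argmin-nothing τ (queue s) e) (queued-∈ s qw)
  ...   | ()

  -- Invariant: a vertex w outside P ∪ Q has val(w) = f(w) - (number of edges
  -- from P to w), and val(w) ≥ 0 unless f(w) < 0.  If Q empties early, the
  -- set of unprocessed vertices violates the parking condition.

  processedDeg : OState n → Fin (suc n) → ℕ
  processedDeg s = outdeg H (λ y → not (inP s y))

  unprocessed : OState n → ℕ
  unprocessed s = sumFin (λ w → if inP s w then 0 else 1)

  processedDeg-process : ∀ s v w → inP s v ≡ false →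
                         processedDeg (process s v) w ≡ processedDeg s w + mult H v w
  processedDeg-process s v w pv = sumFin-bump _ _ v new old
    where
    new : (if not (inP (process s v) v) then 0 else mult H v w) ≡ (if not (inP s v) then 0 else mult H v w) + mult H v w
    new rewrite process-inP-self s v | pv = refl
    old : ∀ y → y ≢ v → (if not (inP (process s v) y) then 0 else mult H y w) ≡ (if not (inP s y) then 0 else mult H y w)
    old y y≢v rewrite process-inP-other s v y≢v = refl

  unprocessed-process : ∀ s v → inP s v ≡ false → unprocessed s ≡ suc (unprocessed (process s v))
  unprocessed-process s v pv = trans (sumFin-bump _ _ v new old) (ℕP.+-comm _ 1)
    where
    new : (if inP s v then 0 else 1) ≡ (if inP (process s v) v then 0 else 1) + 1
    new rewrite process-inP-self s v | pv = refl
    old : ∀ y → y ≢ v → (if inP s y then 0 else 1) ≡ (if inP (process s v) y then 0 else 1)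
    old y y≢v rewrite process-inP-other s v y≢v = refl

  module Visit (f : Fn n) (pf : IsPF H f) where

    record Invariant (s : OState n) : Set where
      field
        recorded  : ∀ w → inP s w ≡ true → memb (out s) w ≡ true
        disjoint  : ∀ w → inP s w ≡ true → inQ s w ≡ false
        untouched : ∀ w → inP s w ≡ false → inQ s w ≡ false →
                    val s w ≡ lookup f w ℤ.- + processedDeg s w × (lookup f w ℤ.< + 0 ⊎ + 0 ℤ.≤ val s w)
        root-seen : inQ s zero ≡ true ⊎ inP s zero ≡ true
    open Invariant

    not-processed : ∀ {s v} → Invariant s → inQ s v ≡ true → inP s v ≡ false
    not-processed {s} {v} inv qv with inP s v in pv
    ... | false = refl
    ... | true with trans (sym (disjoint inv v pv)) qv
    ...   | ()

    invariant-start : Invariant (start f)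
    invariant-start = record
      { recorded = λ _ () ; disjoint = λ _ () ; untouched = fresh ; root-seen = inj₁ refl }
      where
      fresh : ∀ w → false ≡ false → does (w ≟ zero) ≡ false →
              lookup f w ≡ lookup f w ℤ.- + processedDeg (start f) w
              × (lookup f w ℤ.< + 0 ⊎ + 0 ℤ.≤ lookup f w)
      fresh w _ _ = sym (trans (cong (λ d → lookup f w ℤ.- + d) (sumFin-zero {suc n})) (ℤP.+-identityʳ _))
                  , sign (lookup f w)
        where
        sign : ∀ x → x ℤ.< + 0 ⊎ + 0 ℤ.≤ x
        sign x with + 0 ℤ.≤? x
        ... | yes 0≤x = inj₂ 0≤x
        ... | no  0≰x = inj₁ (ℤP.≰⇒> 0≰x)

    invariant-process : ∀ s v → Invariant s → inQ s v ≡ true → Invariant (process s v)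
    invariant-process s v inv qv = record
      { recorded = recorded′ ; disjoint = disjoint′ ; untouched = untouched′ ; root-seen = root-seen′ }
      where
      pv : inP s v ≡ false
      pv = not-processed inv qv
      recorded′ : ∀ w → inP (process s v) w ≡ true → memb (out s ++ v ∷ []) w ≡ true
      recorded′ w pw with w ≟ v
      ... | yes refl = memb-++ʳ (out s) (v ∷ []) (memb-singleton v)
      ... | no _     = memb-++ˡ (out s) (v ∷ []) (recorded inv w pw)
      disjoint′ : ∀ w → inP (process s v) w ≡ true → inQ (process s v) w ≡ false
      disjoint′ w pw with w ≟ v
      ... | yes refl = refl
      ... | no _ rewrite pw | disjoint inv w pw = refl
      untouched′ : ∀ w → inP (process s v) w ≡ false → inQ (process s v) w ≡ false →
                   val (process s v) w ≡ lookup f w ℤ.- + processedDeg (process s v) w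
                   × (lookup f w ℤ.< + 0 ⊎ + 0 ℤ.≤ val (process s v) w)
      untouched′ w pw′ qw′ = value , sign
        where
        pw : inP s w ≡ false
        pw = proj₁ (stayed-outside s v w pw′ qw′)
        qw : inQ s w ≡ false
        qw = proj₁ (proj₂ (stayed-outside s v w pw′ qw′))
        jw : Joins (val s w) (mult H w v) ≡ false
        jw = proj₂ (proj₂ (stayed-outside s v w pw′ qw′))
        old : val s w ≡ lookup f w ℤ.- + processedDeg s w × (lookup f w ℤ.< + 0 ⊎ + 0 ℤ.≤ val s w)
        old = untouched inv w pw qw
        value : val (process s v) w ≡ lookup f w ℤ.- + processedDeg (process s v) w
        value = begin
          val (process s v) w
            ≡⟨ process-val s v pw qw jw ⟩
          val s w ℤ.- + mult H w v
            ≡⟨ cong₂ (λ a b → a ℤ.- + b) (proj₁ old) (Multigraph.sym H w v) ⟩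
          (lookup f w ℤ.- + processedDeg s w) ℤ.- + mult H v w
            ≡⟨ regroup (lookup f w) (+ processedDeg s w) (+ mult H v w) ⟩
          lookup f w ℤ.- (+ processedDeg s w ℤ.+ + mult H v w)
            ≡⟨ cong (λ d → lookup f w ℤ.- + d) (sym (processedDeg-process s v w pv)) ⟩
          lookup f w ℤ.- + processedDeg (process s v) w
            ∎
          where
          open ≡-Reasoning
          regroup : ∀ (a b c : ℤ) → (a ℤ.- b) ℤ.- c ≡ a ℤ.- (b ℤ.+ c)
          regroup = solve-∀
        sign : lookup f w ℤ.< + 0 ⊎ + 0 ℤ.≤ val (process s v) w
        sign with proj₂ old
        ... | inj₁ fw<0   = inj₁ fw<0
        ... | inj₂ 0≤valw = inj₂ (subst (+ 0 ℤ.≤_) (sym (process-val s v pw qw jw)) (Joins-false _ _ jw 0≤valw))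
      root-seen′ : inQ (process s v) zero ≡ true ⊎ inP (process s v) zero ≡ true
      root-seen′ with zero ≟ v
      ... | yes refl = inj₂ refl
      ... | no _ with root-seen inv
      ...   | inj₁ q0 rewrite q0 = inj₁ refl
      ...   | inj₂ p0 = inj₂ p0

    -- with the queue empty, the unprocessed vertices would violate the parking condition
    complete-when-stuck : ∀ s → Invariant s → (∀ w → inQ s w ≡ false) → ∀ w → inP s w ≡ true
    complete-when-stuck s inv noQ w with inP s w in pw
    ... | true  = refl
    ... | false = ⊥-elim violation
      where
      unvisited : VSet n
      unvisited y = not (inP s y)
      root-unvisited : unvisited zero ≡ false
      root-unvisited with root-seen inv
      ... | inj₁ q0 with trans (sym (noQ zero)) q0
      ...   | ()
      root-unvisited | inj₂ p0 rewrite p0 = refl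
      violation : ⊥
      violation with proj₂ (proj₂ pf) unvisited root-unvisited (w , cong not pw)
      ... | x , x-unvisited , 0≤fx , fx<deg
          with untouched inv x (Equivalence.to T-not-≡ (Equivalence.from T-≡ x-unvisited)) (noQ x)
      ...   | _ , inj₁ fx<0 = ℤP.<⇒≱ fx<0 0≤fx
      ...   | valx , inj₂ 0≤valx = ℤP.<⇒≱ fx<deg (ℤP.0≤i-j⇒j≤i (subst (+ 0 ℤ.≤_) valx 0≤valx))

    Complete : OState n → Set
    Complete t = Invariant t × (∀ w → inP t w ≡ true)

    run-complete : ∀ k s → Invariant s → unprocessed s ≤ k → Complete (orun H τ k s)
    run-complete ℕ.zero s inv none = inv , all-in
      where
      all-in : ∀ w → inP s w ≡ true
      all-in w with inP s w in pw | sumFin-elem (λ y → if inP s y then 0 else 1) w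
      ... | true  | _     = refl
      ... | false | 1≤cnt with ℕP.≤-trans 1≤cnt none
      ...   | ()
    run-complete (suc k) s inv cnt≤ = by-choice (argminRank τ (queue s)) refl
      where
      by-choice : ∀ c → argminRank τ (queue s) ≡ c → Complete (orun H τ (suc k) s)
      by-choice nothing e = subst Complete (sym (run-stuck (suc k) s e))
                              (inv , complete-when-stuck s inv (empty-queue s e))
      by-choice (just v) e = subst Complete (sym (run-step k s v e))
        (run-complete k (process s v) (invariant-process s v inv qv)
          (ℕP.≤-pred (subst (_≤ suc k) (unprocessed-process s v (not-processed inv qv)) cnt≤)))
        where
        qv : inQ s v ≡ true
        qv = chosen-queued s e

    all-visited : ∀ w → memb (Ord H τ f) w ≡ true
    all-visited w = recorded (proj₁ complete) w (proj₂ complete w)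
      where
      complete : Complete (orun H τ (suc n) (start f))
      complete = run-complete (suc n) (start f) invariant-start (ℕP.≤-reflexive (sumFin-ones (suc n)))

-- If two graphs have the same edges away from the root, then
-- once the root has been processed their runs stay in lockstep: the two
-- states agree on P, Q, the output, and the values of untouched vertices.

module Simulation {n : ℕ} (G D : Multigraph n) (τ : Ranking n)
                  (same : ∀ w v → w ≢ zero → v ≢ zero → mult D w v ≡ mult G w v) where
  open OState
  module OG = Ordering G τ
  module OD = Ordering D τ

  record Agree (s t : OState n) : Set where
    field
      same-val : ∀ w → OG.outside s w ≡ true → val s w ≡ val t w
      same-P   : ∀ w → inP s w ≡ inP t w
      same-Q   : ∀ w → inQ s w ≡ inQ t w
      same-out : out s ≡ out t
  open Agree

  same-queue : ∀ s t → Agree s t → OG.queue s ≡ OD.queue t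
  same-queue s t a = filter-≐ (λ x → T? (inQ s x)) (λ x → T? (inQ t x))
                   ((λ {x} p → subst T (same-Q a x) p) , (λ {x} p → subst T (sym (same-Q a x)) p)) (allV n)

  outside-≢root : ∀ s w → OG.RootDone s → OG.outside s w ≡ true → w ≢ zero
  outside-≢root s w (p0 , _) o refl rewrite p0 with o
  ... | ()

  process-agree : ∀ s t v → Agree s t → OG.RootDone s → v ≢ zero → Agree (OG.process s v) (OD.process t v)
  process-agree s t v a done v≢0 = record
    { same-val = same-val′ ; same-P = λ w → cong (does (w ≟ v) ∨_) (same-P a w)
    ; same-Q = same-Q′ ; same-out = cong (_++ v ∷ []) (same-out a) }
    where
    same-outside : ∀ w → OG.outside s w ≡ OD.outside t w
    same-outside w rewrite same-P a w | same-Q a w = refl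
    same-joins : ∀ w → OG.outside s w ≡ true → Joins (val s w) (mult G w v) ≡ Joins (val t w) (mult D w v)
    same-joins w o rewrite same-val a w o | same w v (outside-≢root s w done o) v≢0 = refl
    same-enters : ∀ w → (OG.outside s w ∧ Joins (val s w) (mult G w v)) ≡ (OD.outside t w ∧ Joins (val t w) (mult D w v))
    same-enters w with OG.outside s w in o | OD.outside t w in o′ | same-outside w
    ... | false | .false | refl = refl
    ... | true  | .true  | refl = same-joins w o
    same-Q′ : ∀ w → inQ (OG.process s v) w ≡ inQ (OD.process t v) w
    same-Q′ w with w ≟ v
    ... | yes refl = refl
    ... | no _     = cong₂ _∨_ (same-Q a w) (same-enters w)
    same-val′ : ∀ w → OG.outside (OG.process s v) w ≡ true → val (OG.process s v) w ≡ val (OD.process t v) w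
    same-val′ w o′ = begin
      val (OG.process s v) w     ≡⟨ OG.process-val s v pw qw jw ⟩
      val s w ℤ.- + mult G w v   ≡⟨ cong₂ (λ a b → a ℤ.- + b) (same-val a w o)
                                          (sym (same w v (outside-≢root s w done o) v≢0)) ⟩
      val t w ℤ.- + mult D w v   ≡⟨ OD.process-val t v (trans (sym (same-P a w)) pw) (trans (sym (same-Q a w)) qw)
                                      (trans (sym (same-joins w o)) jw) ⟨
      val (OD.process t v) w     ∎
      where
      open ≡-Reasoning
      untouched : inP s w ≡ false × inQ s w ≡ false × Joins (val s w) (mult G w v) ≡ false
      untouched = OG.stayed-outside s v w (proj₁ (Equivalence.to (OG.outside⇔ (OG.process s v) w) o′))
                                          (proj₂ (Equivalence.to (OG.outside⇔ (OG.process s v) w) o′))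
      pw : inP s w ≡ false
      pw = proj₁ untouched
      qw : inQ s w ≡ false
      qw = proj₁ (proj₂ untouched)
      jw : Joins (val s w) (mult G w v) ≡ false
      jw = proj₂ (proj₂ untouched)
      o : OG.outside s w ≡ true
      o = Equivalence.from (OG.outside⇔ s w) (pw , qw)

  run-agree : ∀ k s t → Agree s t → OG.RootDone s → out (orun G τ k s) ≡ out (orun D τ k t)
  run-agree ℕ.zero s t a _ = same-out a
  run-agree (suc k) s t a done = by-choice (argminRank τ (OD.queue t)) refl
    where
    by-choice : ∀ c → argminRank τ (OD.queue t) ≡ c → out (orun G τ (suc k) s) ≡ out (orun D τ (suc k) t)
    by-choice nothing e =
      trans (cong out (OG.run-stuck (suc k) s (trans (cong (argminRank τ) (same-queue s t a)) e)))
        (trans (same-out a) (cong out (sym (OD.run-stuck (suc k) t e))))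
    by-choice (just v) e =
      trans (cong out (OG.run-step k s v eG))
        (trans (run-agree k _ _ (process-agree s t v a done v≢0) (OG.process-RootDone s v done v≢0))
               (cong out (sym (OD.run-step k t v e))))
      where
      eG : argminRank τ (OG.queue s) ≡ just v
      eG = trans (cong (argminRank τ) (same-queue s t a)) e
      v≢0 : v ≢ zero
      v≢0 = OG.chosen-≢root s done eG

module DeletionOrder {n : ℕ} (G : Multigraph n) (τ : Ranking n) (u : Fin n) (hu : 1 ≤ mult G zero (suc u)) where
  open OState
  open Deletion G u hu
  open Simulation G D τ mult-off-root

  InP¹ : Fn n → Set
  InP¹ f = IsPF G f × + 1 ℤ.≤ lookup f (suc u)

  mult-to-root : ∀ x → mult G x zero ≡ mult D x zero + δ x
  mult-to-root x = trans (Multigraph.sym G x zero)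
                     (trans (mult-root x) (cong (λ m → m + δ x) (Multigraph.sym D zero x)))

  first-step-agrees : ∀ f → InP¹ f → Agree (OG.afterRoot f) (OD.afterRoot (φ u f))
  first-step-agrees f f∈P¹ = record
    { same-val = same-val′ ; same-P = λ _ → refl ; same-Q = same-Q′ ; same-out = refl }
    where
    nonneg : ∀ x → x ≢ zero → + 0 ℤ.≤ lookup (φ u f) x
    nonneg = pf-nonneg D (φ u f) (Equivalence.to (pf-φ⇔ f) f∈P¹)
    same-joins : ∀ x → x ≢ zero → Joins (lookup f x) (mult G x zero) ≡ Joins (lookup (φ u f) x) (mult D x zero)
    same-joins x x≢0 = subst₂ (λ a b → Joins a b ≡ Joins (lookup (φ u f) x) (mult D x zero))
                         (sym (lookup-φ f x)) (sym (mult-to-root x)) (Joins-shift _ _ (δ x) (nonneg x x≢0))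
    same-Q′ : ∀ x → inQ (OG.afterRoot f) x ≡ inQ (OD.afterRoot (φ u f)) x
    same-Q′ zero    = refl
    same-Q′ (suc x) = same-joins (suc x) (λ ())
    same-val′ : ∀ x → OG.outside (OG.afterRoot f) x ≡ true → val (OG.afterRoot f) x ≡ val (OD.afterRoot (φ u f)) x
    same-val′ zero    ()
    same-val′ (suc x) o with Joins (lookup f (suc x)) (mult G (suc x) zero) | same-joins (suc x) (λ ())
    ... | false | jD = begin
      lookup f (suc x) ℤ.- + mult G (suc x) zero
        ≡⟨ cong₂ (λ a b → a ℤ.- + b) (lookup-φ f (suc x)) (mult-to-root (suc x)) ⟩
      (lookup (φ u f) (suc x) ℤ.+ + δ (suc x)) ℤ.- (+ mult D (suc x) zero ℤ.+ + δ (suc x))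
        ≡⟨ cancel (lookup (φ u f) (suc x)) (+ mult D (suc x) zero) (+ δ (suc x)) ⟩
      lookup (φ u f) (suc x) ℤ.- + mult D (suc x) zero
        ≡⟨ OD.process-val (OD.start (φ u f)) zero refl refl (sym jD) ⟨
      val (OD.afterRoot (φ u f)) (suc x) ∎
      where
      open ≡-Reasoning
      cancel : ∀ (a b c : ℤ) → (a ℤ.+ c) ℤ.- (b ℤ.+ c) ≡ a ℤ.- b
      cancel = solve-∀

  Ord-φ : ∀ f → InP¹ f → Ord G τ f ≡ Ord D τ (φ u f)
  Ord-φ f f∈P¹ = begin
    Ord G τ f                               ≡⟨ OG.Ord-afterRoot f ⟩
    out (orun G τ n (OG.afterRoot f))        ≡⟨ run-agree n _ _ (first-step-agrees f f∈P¹) (refl , refl) ⟩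
    out (orun D τ n (OD.afterRoot (φ u f)))  ≡⟨ OD.Ord-afterRoot (φ u f) ⟨
    Ord D τ (φ u f)                         ∎
    where open ≡-Reasoning

-- Weak identity with the orders Ord(f) and Ord(g) given explicitly as lists;
-- WeakId H τ f i v g is WeakIdOn H τ (Ord H τ f) (Ord H τ g) f i v g.

WeakIdOn : ∀ {n} → Multigraph n → Ranking n → (Of Og : List (Fin (suc n))) → Fn n → ℕ → Fin (suc n) → Fn n → Set
WeakIdOn H τ Of Og f i v g =
    IsPF H g
  × List.take i Og ≡ List.take i Of
  × List.map (lookup g) (List.take i Og) ≡ List.map (lookup f) (List.take i Of)
  × lookup f v ℤ.≤ lookup g v
  × (∀ w → memb (List.drop i Of) w ≡ true → rank τ w < rank τ v →
       + outdeg H (memb (List.drop i Of)) w ℤ.≤ lookup g w)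

module IdentityTransfer {n : ℕ} (G : Multigraph n) (τ : Ranking n) (u : Fin n) (hu : 1 ≤ mult G zero (suc u)) where
  open Deletion G u hu
  open DeletionOrder G τ u hu
  module OG = Ordering G τ

  -- the comparison 'outdeg ≤ value' of the third weak-identity condition
  flip-≤ : RespectsShift (λ a b → b ℤ.≤ a)
  flip-≤ c = shift-≤ c

  -- the threshold outdeg - 1 of criticality
  pred-shift : Shifting (λ d → + d ℤ.- + 1)
  pred-shift d c = regroup (+ d) (+ c)
    where
    regroup : ∀ (a b : ℤ) → (a ℤ.+ b) ℤ.- + 1 ≡ (a ℤ.- + 1) ℤ.+ b
    regroup = solve-∀

  map-transfer : ∀ f g L → (List.map (lookup g) L ≡ List.map (lookup f) L) ⇔
                           (List.map (lookup (φ u g)) L ≡ List.map (lookup (φ u f)) L)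
  map-transfer f g []      = mk⇔ (λ _ → refl) (λ _ → refl)
  map-transfer f g (x ∷ L) = mk⇔
    (λ e → cong₂ _∷_ (Equivalence.to (values-transfer shift-≡ g f x) (∷-injectiveˡ e))
                     (Equivalence.to (map-transfer f g L) (∷-injectiveʳ e)))
    (λ e → cong₂ _∷_ (Equivalence.from (values-transfer shift-≡ g f x) (∷-injectiveˡ e))
                     (Equivalence.from (map-transfer f g L) (∷-injectiveʳ e)))

  prefix-transfer : ∀ f g {A B} → A ≡ B →
                    (List.map (lookup g) A ≡ List.map (lookup f) B) ⇔
                    (List.map (lookup (φ u g)) A ≡ List.map (lookup (φ u f)) B)
  prefix-transfer f g {A} refl = map-transfer f g A

  weakOn-transfer : ∀ f g i v Of Og → memb (List.drop i Of) zero ≡ false → InP¹ g →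
                    WeakIdOn G τ Of Og f i v g ⇔ WeakIdOn D τ Of Og (φ u f) i v (φ u g)
  weakOn-transfer f g i v Of Og J0 g∈P¹ = mk⇔ toD toG
    where
    J : VSet n
    J = memb (List.drop i Of)
    later-transfer : ∀ w → J w ≡ true → (+ outdeg G J w ℤ.≤ lookup g w) ⇔ (+ outdeg D J w ℤ.≤ lookup (φ u g) w)
    later-transfer w Jw = degree-transfer flip-≤ {+_} (λ _ _ → refl) g J w J0 (member-≢root {I = J} J0 Jw)
    toD : WeakIdOn G τ Of Og f i v g → WeakIdOn D τ Of Og (φ u f) i v (φ u g)
    toD (_ , same-order , same-values , f≤g , later) =
      Equivalence.to (pf-φ⇔ g) g∈P¹ , same-order
      , Equivalence.to (prefix-transfer f g same-order) same-values
      , Equivalence.to (values-transfer shift-≤ f g v) f≤g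
      , λ w Jw r → Equivalence.to (later-transfer w Jw) (later w Jw r)
    toG : WeakIdOn D τ Of Og (φ u f) i v (φ u g) → WeakIdOn G τ Of Og f i v g
    toG (_ , same-order , same-values , f≤g , later) =
      proj₁ g∈P¹ , same-order
      , Equivalence.from (prefix-transfer f g same-order) same-values
      , Equivalence.from (values-transfer shift-≤ f g v) f≤g
      , λ w Jw r → Equivalence.from (later-transfer w Jw) (later w Jw r)

  module _ (f : Fn n) (f∈P¹ : InP¹ f) (j : ℕ) (v : Fin n) where

    critical-transfer : Critical G τ f (suc j) (suc v) ⇔ Critical D τ (φ u f) (suc j) (suc v)
    critical-transfer =
      subst (λ J → Critical G τ f (suc j) (suc v) ⇔ (lookup (φ u f) (suc v) ≡ + outdeg D J (suc v) ℤ.- + 1))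
        (cong (λ L → memb (List.drop (suc j) L)) (Ord-φ f f∈P¹))
        (degree-transfer shift-≡ {λ d → + d ℤ.- + 1} pred-shift f (Iset G τ f (suc j)) (suc v) (OG.root-not-later f j) (λ ()))

    -- weak and strong identity transfer along φ, as Ord is unchanged
    weak-transfer : ∀ g → InP¹ g → WeakId G τ f (suc j) (suc v) g ⇔ WeakId D τ (φ u f) (suc j) (suc v) (φ u g)
    weak-transfer g g∈P¹ =
      subst₂ (λ A B → WeakId G τ f (suc j) (suc v) g ⇔ WeakIdOn D τ A B (φ u f) (suc j) (suc v) (φ u g))
        (Ord-φ f f∈P¹) (Ord-φ g g∈P¹)
        (weakOn-transfer f g (suc j) (suc v) (Ord G τ f) (Ord G τ g) (OG.root-not-later f j) g∈P¹)

    strong-transfer : ∀ g → InP¹ g → StrongId G τ f (suc j) (suc v) g ⇔ StrongId D τ (φ u f) (suc j) (suc v) (φ u g)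
    strong-transfer g g∈P¹ = mk⇔
      (λ (weak , at-i) → Equivalence.to (weak-transfer g g∈P¹) weak , subst At-i (Ord-φ g g∈P¹) at-i)
      (λ (weak , at-i) → Equivalence.from (weak-transfer g g∈P¹) weak , subst At-i (sym (Ord-φ g g∈P¹)) at-i)
      where
      At-i : List (Fin (suc n)) → Set
      At-i L = at L (suc j) ≡ just (suc v)

-- This is where the minimality of u among the
-- neighbours of the root is used: a parking function g with g(u) = 0
-- processes u right after the root, which is incompatible with weak identity.

module BridgeTransfer {n : ℕ} (G : Multigraph n) (τ : Ranking n) (u : Fin n) (hu : 1 ≤ mult G zero (suc u))
                      (hmin : ∀ (w : Fin n) → 1 ≤ mult G zero (suc w) → rank τ (suc u) ≤ rank τ (suc w)) where
  open OState
  open Deletion G u hu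
  open DeletionOrder G τ u hu
  open IdentityTransfer G τ u hu

  1≤n : 1 ≤ n
  1≤n = ℕP.≤-trans (s≤s z≤n) (toℕ<n u)

  queued-neighbour : ∀ g y → inQ (OG.afterRoot g) (suc y) ≡ true → 1 ≤ mult G zero (suc y)
  queued-neighbour g y q
    with Equivalence.to (Joins-true (lookup g (suc y)) (mult G (suc y) zero))
                        (trans (sym (OG.afterRoot-queue g (suc y) (λ ()))) q)
  ... | 0≤gy , gy<μ with ℤP.≤-<-trans 0≤gy gy<μ
  ...   | ℤ.+<+ 0<μ = subst (1 ≤_) (Multigraph.sym G (suc y) zero) 0<μ

  u-queued : ∀ g → lookup g (suc u) ≡ + 0 → inQ (OG.afterRoot g) (suc u) ≡ true
  u-queued g gu≡0 = trans (OG.afterRoot-queue g (suc u) (λ ()))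
    (Equivalence.from (Joins-true _ _)
      ( subst (+ 0 ℤ.≤_) (sym gu≡0) ℤP.≤-refl
      , subst₂ ℤ._<_ (sym gu≡0) (cong +_ (Multigraph.sym G zero (suc u))) (ℤ.+<+ hu)))

  -- ... and, having the smallest rank among the root's neighbours, is processed next
  u-second : ∀ g → lookup g (suc u) ≡ + 0 → at (Ord G τ g) 1 ≡ just (suc u)
  u-second g gu≡0 = trans (OG.second-entry g 1≤n) (u-chosen (argminRank τ (OG.queue (OG.afterRoot g))) refl)
    where
    u-chosen : ∀ c → argminRank τ (OG.queue (OG.afterRoot g)) ≡ c → c ≡ just (suc u)
    u-chosen nothing e with trans (sym (OG.empty-queue (OG.afterRoot g) e (suc u))) (u-queued g gu≡0)
    ... | ()
    u-chosen (just zero)    e = ⊥-elim (OG.chosen-≢root (OG.afterRoot g) (refl , refl) e refl)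
    u-chosen (just (suc y)) e = cong just (rank-injective τ (ℕP.≤-antisym
      (proj₂ (argmin-just τ _ _ e) (suc u) (OG.queued-∈ (OG.afterRoot g) (u-queued g gu≡0)))
      (hmin y (queued-neighbour g y (OG.chosen-queued (OG.afterRoot g) e)))))

  below-zero : ∀ {x : ℕ} {y : ℤ} → y ≡ + 0 → + x ℤ.≤ y → x ≤ 0
  below-zero refl (ℤ.+≤+ x≤0) = x≤0

  -- Weak identity forces g(u) ≠ 0.  If v comes after u in Ord(f), the prefix
  -- condition gives g(u) = f(u) ≥ 1.  If v is the second vertex of Ord(f),
  -- then either v = u and g(u) ≥ f(u) ≥ 1, or u ranks before v and lies in
  -- I_v, so that g(u) ≥ outdeg_{I_v}(u) ≥ μ(0,u) ≥ 1.
  weak-u≢0 : ∀ f → InP¹ f → ∀ j v → at (Ord G τ f) (suc j) ≡ just (suc v) →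
             ∀ g → WeakId G τ f (suc j) (suc v) g → lookup g (suc u) ≢ + 0
  weak-u≢0 f (_ , f1) (suc j) v _ g (_ , same-order , same-values , _ , _) gu≡0
    with first-two (Ord G τ g) (OG.Ord-head g) (u-second g gu≡0)
  ... | R , g-order = ℕP.n≮0 (below-zero gu≡0 (subst (+ 1 ℤ.≤_) (sym gu≡fu) f1))
    where
    prefix : List (Fin (suc n)) → List (Fin (suc n))
    prefix = List.take (suc (suc j))
    agree : List.map (lookup g) (prefix (Ord G τ g)) ≡ List.map (lookup f) (prefix (Ord G τ g))
    agree = trans same-values (cong (List.map (lookup f)) (sym same-order))
    gu≡fu : lookup g (suc u) ≡ lookup f (suc u)
    gu≡fu = ∷-injectiveˡ (∷-injectiveʳ
              (subst (λ L → List.map (lookup g) (prefix L) ≡ List.map (lookup f) (prefix L)) g-order agree))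
  weak-u≢0 f (pf , f1) ℕ.zero v at-1 g (_ , _ , _ , f≤g , later) gu≡0 with v ≟ u
  ... | yes refl = ℕP.n≮0 (below-zero gu≡0 (ℤP.≤-trans f1 f≤g))
  ... | no v≢u   = ℕP.n≮0 (ℕP.≤-trans hu (ℕP.≤-trans (root-edges-≤-outdeg G I (suc u) (OG.root-not-later f 0))
                                                    (below-zero gu≡0 (later (suc u) u-later u<v))))
    where
    I : VSet n
    I = Iset G τ f 1
    v-queued : inQ (OG.afterRoot f) (suc v) ≡ true
    v-queued = OG.chosen-queued (OG.afterRoot f) (trans (sym (OG.second-entry f 1≤n)) at-1)
    u<v : rank τ (suc u) < rank τ (suc v)
    u<v = ℕP.≤∧≢⇒< (hmin v (queued-neighbour f v v-queued))
                    (λ e → v≢u (sym (suc-injective (rank-injective τ e))))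
    u-later : I (suc u) ≡ true
    u-later with OG.ord-shape f
    ... | R , shape , _ = subst (λ L → memb (List.drop 1 L) (suc u) ≡ true) (sym shape)
                            (subst (λ L → memb L (suc u) ≡ true) shape (OG.Visit.all-visited f pf (suc u)))

  module _ (f : Fn n) (f∈P¹ : InP¹ f) (j : ℕ) (v : Fin n) (at-i : at (Ord G τ f) (suc j) ≡ just (suc v)) where

    weak-in-P¹ : ∀ g → WeakId G τ f (suc j) (suc v) g → InP¹ g
    weak-in-P¹ g weak = proj₁ weak
      , positive (lookup g (suc u)) (pf-nonneg G g (proj₁ weak) (suc u) (λ ())) (weak-u≢0 f f∈P¹ j v at-i g weak)
      where
      positive : ∀ x → + 0 ℤ.≤ x → x ≢ + 0 → + 1 ℤ.≤ x
      positive (+ ℕ.zero)  _ x≢0 = ⊥-elim (x≢0 refl)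
      positive (+ suc k)   _ _   = ℤ.+≤+ (s≤s z≤n)

    ψ∈P¹ : ∀ h → IsPF D h → InP¹ (ψ h)
    ψ∈P¹ h pfh = Equivalence.from (pf-φ⇔ (ψ h)) (subst (IsPF D) (sym (φ∘ψ h)) pfh)

    weak-φ : ∀ g → WeakId G τ f (suc j) (suc v) g → WeakId D τ (φ u f) (suc j) (suc v) (φ u g)
    weak-φ g weak = Equivalence.to (weak-transfer f f∈P¹ j v g (weak-in-P¹ g weak)) weak

    weak-ψ : ∀ h → WeakId D τ (φ u f) (suc j) (suc v) h → WeakId G τ f (suc j) (suc v) (ψ h)
    weak-ψ h weak = Equivalence.from (weak-transfer f f∈P¹ j v (ψ h) (ψ∈P¹ h (proj₁ weak)))
                      (subst (WeakId D τ (φ u f) (suc j) (suc v)) (sym (φ∘ψ h)) weak)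

    strong-φ : ∀ g → StrongId G τ f (suc j) (suc v) g → StrongId D τ (φ u f) (suc j) (suc v) (φ u g)
    strong-φ g strong = Equivalence.to (strong-transfer f f∈P¹ j v g (weak-in-P¹ g (proj₁ strong))) strong

    strong-ψ : ∀ h → StrongId D τ (φ u f) (suc j) (suc v) h → StrongId G τ f (suc j) (suc v) (ψ h)
    strong-ψ h strong = Equivalence.from (strong-transfer f f∈P¹ j v (ψ h) (ψ∈P¹ h (proj₁ (proj₁ strong))))
                          (subst (StrongId D τ (φ u f) (suc j) (suc v)) (sym (φ∘ψ h)) strong)

    same-card⇔ : SameCard (WeakId G τ f (suc j) (suc v)) (StrongId G τ f (suc j) (suc v)) ⇔
                 SameCard (WeakId D τ (φ u f) (suc j) (suc v)) (StrongId D τ (φ u f) (suc j) (suc v))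
    same-card⇔ = mk⇔ (SameCard-transport (φ u) ψ ψ∘φ φ∘ψ weak-φ weak-ψ strong-φ strong-ψ)
                     (SameCard-transport ψ (φ u) φ∘ψ ψ∘φ weak-ψ weak-φ strong-ψ strong-φ)

  bridge-transfer : ∀ f → InP¹ f → ∀ v → Bridge G τ f v ⇔ Bridge D τ (φ u f) v
  bridge-transfer f f∈P¹ v = mk⇔ toD toG
    where
    at-φ : ∀ i → at (Ord G τ f) i ≡ at (Ord D τ (φ u f)) i
    at-φ i = cong (λ L → at L i) (Ord-φ f f∈P¹)
    root≢v : ∀ (H : Multigraph n) h → at (Ord H τ h) 0 ≢ just (suc v)
    root≢v H h e with trans (sym (Ordering.Ord-head H τ h)) e
    ... | ()
    toD : Bridge G τ f v → Bridge D τ (φ u f) v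
    toD (ℕ.zero  , at-i , _)             = ⊥-elim (root≢v G f at-i)
    toD (suc j , at-i , critical , card) =
      suc j , trans (sym (at-φ (suc j))) at-i
      , Equivalence.to (critical-transfer f f∈P¹ j v) critical
      , Equivalence.to (same-card⇔ f f∈P¹ j v at-i) card
    toG : Bridge D τ (φ u f) v → Bridge G τ f v
    toG (ℕ.zero  , at-i , _)             = ⊥-elim (root≢v D (φ u f) at-i)
    toG (suc j , at-i , critical , card) =
      suc j , at-iG
      , Equivalence.from (critical-transfer f f∈P¹ j v) critical
      , Equivalence.from (same-card⇔ f f∈P¹ j v at-iG) card
      where
      at-iG : at (Ord G τ f) (suc j) ≡ just (suc v)
      at-iG = trans (at-φ (suc j)) at-i

lemma3p2 : (n : ℕ) (G : Multigraph n) → Connected G → (τ : Ranking n) →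
           (u : Fin n) → 1 ≤ mult G zero (suc u) →
           (∀ (w : Fin n) → 1 ≤ mult G zero (suc w) → rank τ (suc u) ≤ rank τ (suc w)) →
           -- (1) φ maps P¹_G into P_{G-e}, preserving weight ...
           (∀ (f : Fn n) → IsPF G f → + 1 ℤ.≤ lookup f (suc u) →
              IsPF (deleteEdge G u) (φ u f)
              × weight (deleteEdge G u) (φ u f) ≡ weight G f)
           -- ... injectively on P¹_G ...
           × (∀ (f g : Fn n) → IsPF G f → + 1 ℤ.≤ lookup f (suc u) →
              IsPF G g → + 1 ℤ.≤ lookup g (suc u) → φ u f ≡ φ u g → f ≡ g)
           -- ... and onto P_{G-e}
           × (∀ (g : Fn n) → IsPF (deleteEdge G u) g →
              ∃ λ f → IsPF G f × + 1 ℤ.≤ lookup f (suc u) × φ u f ≡ g)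
           -- (2) B_{G,τ}(f) = B_{G-e,τ}(φ(f))
           × (∀ (f : Fn n) → IsPF G f → + 1 ℤ.≤ lookup f (suc u) →
              ∀ (v : Fin n) → Bridge G τ f v ⇔ Bridge (deleteEdge G u) τ (φ u f) v)
lemma3p2 n G _ τ u hu hmin =
    (λ f pf f1 → Equivalence.to (pf-φ⇔ f) (pf , f1) , weight-φ f)
  , (λ f g _ _ _ _ → φ-injective f g)
  , φ-onto
  , (λ f pf f1 → bridge-transfer f (pf , f1))
  where
  open Deletion G u hu
  open BridgeTransfer G τ u hu hmin
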